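{- Let $G$ be a graph with $n$ vertices such that $M=M[IAS(G)]$ is 3-connected, with ground set $W(M)$ and rank function $r$. Then: \begin{enumerate} \item every subset $S\subseteq W(M)$ with $|S|\ge4$ has $r(S)\ge3$; \item every subset $S\subseteq W(M)$ with $|S|\ge 3n-5$ has $r(S)=n$. \end{enumerate}
   Context: A graph is a finite looped simple graph; $A(G)$ is its $GF(2)$ adjacency matrix (diagonal 1 iff looped). $M[IAS(G)]$ is the binary matroid represented by $(I\;A(G)\;A(G)+I)$; its ground set has $3n$ elements. For a matroid on $W$ with rank $r$, $\lambda(S)=r(S)+r(W-S)-r(M)$; $S$ is an ordinary $k$-separation if $\lambda(S)<k$ and $|S|,|W-S|\ge k$; $M$ is 3-connected if it has no ordinary $1$- or $2$-separation. -}

module Defs where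

open import Data.Bool using (Bool; true; false; _∧_; _∨_; not; _xor_; if_then_else_)
open import Data.Nat using (ℕ; zero; suc; _+_; _∸_; _<_; _≤_; _⊔_)
open import Data.Fin using (Fin; zero; suc; splitAt; _≟_)
open import Data.Fin.Subset using (Subset; ∣_∣; ∁; ⊤)
open import Data.Vec using (Vec; []; _∷_)
open import Data.List using (List; []; _∷_; map; _++_; foldr; allFin)
open import Data.Bool.ListAction using (and)
open import Data.Sum using (inj₁; inj₂)
open import Data.Product using (_×_)
open import Relation.Nullary.Decidable using (⌊_⌋)
open import Relation.Nullary using (¬_)
open import Relation.Binary.PropositionalEquality using (_≡_)

-- A looped simple graph on n vertices, given by its GF(2) adjacency matrix
-- (Bool = GF(2), xor = addition); symmetric, diagonal = loops.
Graph : ℕ → Set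
Graph n = Fin n → Fin n → Bool

Symmetric : ∀ {n} → Graph n → Set
Symmetric {n} A = (i j : Fin n) → A i j ≡ A j i

GF2Vec : ℕ → Set
GF2Vec n = Fin n → Bool

isZeroVec : ∀ {n} → GF2Vec n → Bool
isZeroVec {n} v = and (map (λ i → not (v i)) (allFin n))

allSubsets : (m : ℕ) → List (Subset m)
allSubsets zero = [] ∷ []
allSubsets (suc m) = map (true ∷_) (allSubsets m) ++ map (false ∷_) (allSubsets m)

subsetOf : ∀ {m} → Subset m → Subset m → Bool
subsetOf [] [] = true
subsetOf (a ∷ S) (b ∷ T) = (not a ∨ b) ∧ subsetOf S T

nonempty : ∀ {m} → Subset m → Bool
nonempty [] = false
nonempty (a ∷ S) = a ∨ nonempty S

sumCols : ∀ {m n} → (Fin m → GF2Vec n) → Subset m → GF2Vec n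
sumCols c [] i = false
sumCols c (b ∷ S) i = (b ∧ c zero i) xor sumCols (λ k → c (suc k)) S i

independent : ∀ {m n} → (Fin m → GF2Vec n) → Subset m → Bool
independent {m} c T =
  and (map (λ U → not (subsetOf U T ∧ nonempty U ∧ isZeroVec (sumCols c U))) (allSubsets m))

maxList : List ℕ → ℕ
maxList = foldr _⊔_ 0

rank : ∀ {m n} → (Fin m → GF2Vec n) → Subset m → ℕ
rank {m} c S =
  maxList (map (λ T → if subsetOf T S ∧ independent c T then ∣ T ∣ else 0) (allSubsets m))

conn : ∀ {m n} → (Fin m → GF2Vec n) → Subset m → ℕ
conn c S = (rank c S + rank c (∁ S)) ∸ rank c ⊤

IsSeparation : ∀ {m n} → (Fin m → GF2Vec n) → ℕ → Subset m → Set
IsSeparation c k S = (conn c S < k) × (k ≤ ∣ S ∣) × (k ≤ ∣ ∁ S ∣)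

ThreeConnected : ∀ {m n} → (Fin m → GF2Vec n) → Set
ThreeConnected {m} c = (S : Subset m) → ¬ IsSeparation c 1 S × ¬ IsSeparation c 2 S

-- ground set W(M[IAS(G)]) : Fin (n + n + n); first n = columns of I,
-- next n = columns of A(G), last n = columns of A(G) + I
W : ℕ → ℕ
W n = n + n + n

δ : ∀ {n} → Fin n → Fin n → Bool
δ i j = ⌊ i ≟ j ⌋

IAS : ∀ {n} → Graph n → Fin (W n) → GF2Vec n
IAS {n} A x with splitAt (n + n) x
... | inj₂ j = λ i → A i j xor δ i j
... | inj₁ y with splitAt n y
...   | inj₁ j = λ i → δ i j
...   | inj₂ j = λ i → A i j

-- Part 1 holds in every 3-connected binary matroid on ≥ 4 elements: the
-- separations {e} and {e, f} rule out loops and parallel pairs, so among four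
-- elements a, b, d, d' of S some triple is independent, or else
-- c_a + c_b + c_d = 0 = c_a + c_b + c_d' and d, d' are parallel.
--
-- Part 2: r(S) ≤ n always; if r(S) < n some nonzero U ∈ GF(2)^n annihilates
-- every column of S.  With a = AU, U takes the values U_v, a_v, U_v + a_v on
-- the columns e_v, A_v, A_v + e_v of v, so a vertex with (U_v, a_v) ≠ 0 has
-- two columns outside S, and |W − S| ≤ 5 allows at most two such vertices.
-- As A is symmetric, Σ_v (U_v A_v + a_v e_v) = AU + a = 0 and each nonzero
-- summand is a column of v: a loop or a parallel pair, which is impossible.

module Submission where

open import Defs
open import Data.Nat using (ℕ; _≤_; _∸_; _*_)
open import Data.Fin.Subset using (Subset; ∣_∣)
open import Data.Product using (_×_)
open import Relation.Binary.PropositionalEquality using (_≡_)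

open import Data.Bool using (Bool; true; false; _∧_; _∨_; not; _xor_; if_then_else_)
import Data.Bool.Properties as BP
open import Data.Nat using (zero; suc; _+_; _<_; z≤n; s≤s)
import Data.Nat.Properties as NP
open import Data.Fin using (Fin; zero; suc; splitAt; _↑ˡ_; _↑ʳ_; _≟_)
import Data.Fin.Properties as FP
open import Data.Fin.Subset using (⊤; ∁; ⁅_⁆) renaming (⊥ to ∅)
import Data.Fin.Subset.Properties as SP
open import Data.Vec using ([]; _∷_; lookup; _[_]≔_)
import Data.Vec.Properties as VP
open import Data.List using (List; []; _∷_; map; _++_; allFin; length)
open import Data.List.Membership.Propositional using (_∈_)
import Data.List.Membership.Propositional.Properties as LMP
import Data.List.Relation.Unary.All.Properties as AllP
open import Data.List.Relation.Unary.Any using (here; there)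
open import Data.List.Relation.Unary.All using (All; []; _∷_)
open import Data.List.Relation.Unary.AllPairs using (AllPairs; []; _∷_)
open import Data.Bool.ListAction using (and)
open import Data.Product using (Σ; _,_; proj₁; proj₂)
open import Data.Sum using (_⊎_; inj₁; inj₂)
open import Data.Empty using (⊥; ⊥-elim)
open import Relation.Nullary using (¬_; yes; no)
open import Relation.Nullary.Decidable using (_×-dec_; ¬?; isYes≗does; dec-true; dec-false)
open import Relation.Binary.PropositionalEquality
  using (refl; sym; trans; cong; cong₂; subst; _≢_; module ≡-Reasoning)

true≢false : true ≢ false
true≢false ()

≢true⇒false : ∀ {b} → b ≢ true → b ≡ false
≢true⇒false {b} b≢true = BP.¬-not b≢true

not-true⇒false : ∀ {b} → not b ≡ true → b ≡ false
not-true⇒false {false} _ = refl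

xor≡false⇒≡ : ∀ {a b} → a xor b ≡ false → a ≡ b
xor≡false⇒≡ {false} {false} _ = refl
xor≡false⇒≡ {true}  {true}  _ = refl

xor-cancel : ∀ a b c d → a xor (b xor c) ≡ false → a xor (b xor d) ≡ false → c ≡ d
xor-cancel a b c d abc abd =
  trans (sym (xor≡false⇒≡ {a xor b} (trans (BP.xor-assoc a b c) abc)))
        (xor≡false⇒≡ {a xor b} (trans (BP.xor-assoc a b d) abd))

xor-leftComm : ∀ a b c → a xor (b xor c) ≡ b xor (a xor c)
xor-leftComm a b c = begin
  a xor (b xor c)  ≡⟨ sym (BP.xor-assoc a b c) ⟩
  (a xor b) xor c  ≡⟨ cong (_xor c) (BP.xor-comm a b) ⟩
  (b xor a) xor c  ≡⟨ BP.xor-assoc b a c ⟩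
  b xor (a xor c)  ∎
  where open ≡-Reasoning

_∈ᵇ_ : ∀ {m} → Fin m → Subset m → Set
j ∈ᵇ U = lookup U j ≡ true

_⊆ᵇ_ : ∀ {m} → Subset m → Subset m → Set
U ⊆ᵇ T = ∀ j → j ∈ᵇ U → j ∈ᵇ T

Inhabited : ∀ {m} → Subset m → Set
Inhabited {m} U = Σ (Fin m) (_∈ᵇ U)

subsetOf-sound : ∀ {m} (U T : Subset m) → subsetOf U T ≡ true → U ⊆ᵇ T
subsetOf-sound (true  ∷ U) (true  ∷ T) h zero    _ = refl
subsetOf-sound (true  ∷ U) (true  ∷ T) h (suc j) j∈U = subsetOf-sound U T h j j∈U
subsetOf-sound (false ∷ U) (b     ∷ T) h (suc j) j∈U = subsetOf-sound U T (BP.∧-conicalʳ _ _ h) j j∈U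
subsetOf-sound (true  ∷ U) (false ∷ T) () _ _

subsetOf-complete : ∀ {m} (U T : Subset m) → U ⊆ᵇ T → subsetOf U T ≡ true
subsetOf-complete []          []      _ = refl
subsetOf-complete (true  ∷ U) (b ∷ T) h rewrite h zero refl = subsetOf-complete U T (λ j → h (suc j))
subsetOf-complete (false ∷ U) (b ∷ T) h = subsetOf-complete U T (λ j → h (suc j))

nonempty-sound : ∀ {m} (U : Subset m) → nonempty U ≡ true → Inhabited U
nonempty-sound (true  ∷ U) _ = zero , refl
nonempty-sound (false ∷ U) h with nonempty-sound U h
... | j , j∈U = suc j , j∈U

nonempty-complete : ∀ {m} (U : Subset m) → Inhabited U → nonempty U ≡ true
nonempty-complete (true  ∷ U) _ = refl
nonempty-complete (false ∷ U) (suc j , j∈U) = nonempty-complete U (j , j∈U)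

and-intro : ∀ {A : Set} (P : A → Bool) xs → (∀ x → P x ≡ true) → and (map P xs) ≡ true
and-intro P []       _ = refl
and-intro P (x ∷ xs) h rewrite h x = and-intro P xs h

and-elim : ∀ {A : Set} (P : A → Bool) {xs x} → x ∈ xs → and (map P xs) ≡ true → P x ≡ true
and-elim P {y ∷ _} (here refl) h = BP.∧-conicalˡ _ _ h
and-elim P {y ∷ _} (there x∈xs) h = and-elim P x∈xs (BP.∧-conicalʳ (P y) _ h)

and-counterexample : ∀ {A : Set} (P : A → Bool) xs → and (map P xs) ≡ false → Σ A (λ x → P x ≡ false)
and-counterexample P (x ∷ xs) h with P x in eq
... | true  = and-counterexample P xs h
... | false = x , eq

isZeroVec-sound : ∀ {n} (v : GF2Vec n) → isZeroVec v ≡ true → ∀ i → v i ≡ false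
isZeroVec-sound v h i = not-true⇒false (and-elim (λ i → not (v i)) (LMP.∈-allFin i) h)

isZeroVec-complete : ∀ {n} (v : GF2Vec n) → (∀ i → v i ≡ false) → isZeroVec v ≡ true
isZeroVec-complete {n} v h = and-intro (λ i → not (v i)) (allFin n) (λ i → cong not (h i))

allSubsets-complete : ∀ {m} (U : Subset m) → U ∈ allSubsets m
allSubsets-complete [] = here refl
allSubsets-complete (true ∷ U) =
  LMP.∈-++⁺ˡ (LMP.∈-map⁺ (true ∷_) (allSubsets-complete U))
allSubsets-complete (false ∷ U) =
  LMP.∈-++⁺ʳ (map (true ∷_) (allSubsets _)) (LMP.∈-map⁺ (false ∷_) (allSubsets-complete U))

lookup-update-other : ∀ {m} (T : Subset m) {j x} b → j ≢ x → lookup (T [ x ]≔ b) j ≡ lookup T j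
lookup-update-other T b j≢x = VP.lookup∘update′ j≢x T b

∉-remove-self : ∀ {m} (T : Subset m) x → lookup (T [ x ]≔ false) x ≡ false
∉-remove-self T x = VP.lookup∘update x T false

∈-insert⁻ : ∀ {m} (T : Subset m) {x} j → j ∈ᵇ (T [ x ]≔ true) → j ≡ x ⊎ j ∈ᵇ T
∈-insert⁻ T {x} j j∈T′ with j ≟ x
... | yes j≡x = inj₁ j≡x
... | no  j≢x = inj₂ (trans (sym (lookup-update-other T true j≢x)) j∈T′)

∈-remove⁻ : ∀ {m} (T : Subset m) {x} j → j ∈ᵇ (T [ x ]≔ false) → j ≢ x × j ∈ᵇ T
∈-remove⁻ T {x} j j∈T′ with j ≟ x
... | yes refl = ⊥-elim (true≢false (trans (sym j∈T′) (∉-remove-self T x)))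
... | no  j≢x  = j≢x , trans (sym (lookup-update-other T false j≢x)) j∈T′

card-insert : ∀ {m} (T : Subset m) x → lookup T x ≡ false → ∣ T [ x ]≔ true ∣ ≡ suc ∣ T ∣
card-insert (false ∷ T) zero    refl = refl
card-insert (true  ∷ T) (suc x) h    = cong suc (card-insert T x h)
card-insert (false ∷ T) (suc x) h    = card-insert T x h

card-remove : ∀ {m} (T : Subset m) x → x ∈ᵇ T → ∣ T ∣ ≡ suc ∣ T [ x ]≔ false ∣
card-remove (true  ∷ T) zero    refl = refl
card-remove (true  ∷ T) (suc x) h    = cong suc (card-remove T x h)
card-remove (false ∷ T) (suc x) h    = card-remove T x h

empty-or-inhabited : ∀ {m} (T : Subset m) → ∣ T ∣ ≡ 0 ⊎ Inhabited T
empty-or-inhabited [] = inj₁ refl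
empty-or-inhabited (true  ∷ T) = inj₂ (zero , refl)
empty-or-inhabited (false ∷ T) with empty-or-inhabited T
... | inj₁ e        = inj₁ e
... | inj₂ (j , j∈T) = inj₂ (suc j , j∈T)

card-mono : ∀ {m} (U T : Subset m) → U ⊆ᵇ T → ∣ U ∣ ≤ ∣ T ∣
card-mono U T U⊆T =
  SP.p⊆q⇒∣p∣≤∣q∣ {p = U} {q = T} (λ {j} j∈U → VP.lookup⇒[]= j T (U⊆T j (VP.[]=⇒lookup j∈U)))

members-bound : ∀ {m} (X : Subset m) (xs : List (Fin m)) →
  AllPairs _≢_ xs → All (_∈ᵇ X) xs → length xs ≤ ∣ X ∣
members-bound X [] _ _ = z≤n
members-bound X (x ∷ xs) (x≢xs ∷ distinct) (x∈X ∷ xs⊆X) =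
  subst (suc (length xs) ≤_) (sym (card-remove X x x∈X))
    (s≤s (members-bound (X [ x ]≔ false) xs distinct (stillIn x≢xs xs⊆X)))
  where
  stillIn : ∀ {ys} → All (x ≢_) ys → All (_∈ᵇ X) ys → All (_∈ᵇ (X [ x ]≔ false)) ys
  stillIn [] [] = []
  stillIn (x≢y ∷ ps) (y∈X ∷ qs) =
    trans (lookup-update-other X false (λ y≡x → x≢y (sym y≡x))) y∈X ∷ stillIn ps qs

distinct-members : ∀ {m} (X : Subset m) k → k ≤ ∣ X ∣ →
  Σ (List (Fin m)) λ xs → length xs ≡ k × AllPairs _≢_ xs × All (_∈ᵇ X) xs
distinct-members X zero    _ = [] , refl , [] , []
distinct-members X (suc k) k<∣X∣ with empty-or-inhabited X
... | inj₁ ∣X∣≡0 = ⊥-elim (NP.≤⇒≯ (NP.≤-reflexive ∣X∣≡0) (NP.≤-trans (s≤s z≤n) k<∣X∣))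
... | inj₂ (x , x∈X)
  with distinct-members (X [ x ]≔ false) k (NP.≤-pred (subst (suc k ≤_) (card-remove X x x∈X) k<∣X∣))
...   | xs , len , distinct , xs⊆X′ =
  x ∷ xs , cong suc len , apart xs⊆X′ ∷ distinct , x∈X ∷ within xs⊆X′
  where
  apart : ∀ {ys} → All (_∈ᵇ (X [ x ]≔ false)) ys → All (x ≢_) ys
  apart [] = []
  apart {y ∷ _} (y∈ ∷ ps) = (λ x≡y → proj₁ (∈-remove⁻ X y y∈) (sym x≡y)) ∷ apart ps
  within : ∀ {ys} → All (_∈ᵇ (X [ x ]≔ false)) ys → All (_∈ᵇ X) ys
  within [] = []
  within {y ∷ _} (y∈ ∷ ps) = proj₂ (∈-remove⁻ X y y∈) ∷ within ps

∈-singleton : ∀ {m} (x : Fin m) → x ∈ᵇ ⁅ x ⁆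
∈-singleton x = VP.[]=⇒lookup (SP.x∈⁅x⁆ x)

∈-singleton⁻ : ∀ {m} (x j : Fin m) → j ∈ᵇ ⁅ x ⁆ → j ≡ x
∈-singleton⁻ x j j∈ = SP.x∈⁅y⁆⇒x≡y x (VP.lookup⇒[]= j ⁅ x ⁆ j∈)

∉-singleton : ∀ {m} (x j : Fin m) → j ≢ x → lookup ⁅ x ⁆ j ≡ false
∉-singleton x j j≢x = ≢true⇒false (λ j∈ → j≢x (∈-singleton⁻ x j j∈))

card-≤1 : ∀ {m} (T : Subset m) x → (∀ j → j ∈ᵇ T → j ≡ x) → ∣ T ∣ ≤ 1
card-≤1 T x only-x = subst (∣ T ∣ ≤_) (SP.∣⁅x⁆∣≡1 x)
  (card-mono T ⁅ x ⁆ (λ j j∈T → subst (_∈ᵇ ⁅ x ⁆) (sym (only-x j j∈T)) (∈-singleton x)))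

pair : ∀ {m} → Fin m → Fin m → Subset m
pair x y = ⁅ x ⁆ [ y ]≔ true

triple : ∀ {m} → Fin m → Fin m → Fin m → Subset m
triple x y z = pair x y [ z ]≔ true

∈-pair⁻ : ∀ {m} (x y j : Fin m) → j ∈ᵇ pair x y → j ≡ x ⊎ j ≡ y
∈-pair⁻ x y j j∈ with ∈-insert⁻ ⁅ x ⁆ j j∈
... | inj₁ j≡y  = inj₂ j≡y
... | inj₂ j∈⁅x⁆ = inj₁ (∈-singleton⁻ x j j∈⁅x⁆)

∈-triple⁻ : ∀ {m} (x y z j : Fin m) → j ∈ᵇ triple x y z → j ≡ x ⊎ j ≡ y ⊎ j ≡ z
∈-triple⁻ x y z j j∈ with ∈-insert⁻ (pair x y) j j∈
... | inj₁ j≡z = inj₂ (inj₂ j≡z)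
... | inj₂ j∈xy with ∈-pair⁻ x y j j∈xy
...   | inj₁ j≡x = inj₁ j≡x
...   | inj₂ j≡y = inj₂ (inj₁ j≡y)

∣pair∣ : ∀ {m} (x y : Fin m) → x ≢ y → ∣ pair x y ∣ ≡ 2
∣pair∣ x y x≢y = trans (card-insert ⁅ x ⁆ y (∉-singleton x y (λ y≡x → x≢y (sym y≡x))))
                       (cong suc (SP.∣⁅x⁆∣≡1 x))

∣triple∣ : ∀ {m} (x y z : Fin m) → x ≢ y → x ≢ z → y ≢ z → ∣ triple x y z ∣ ≡ 3
∣triple∣ x y z x≢y x≢z y≢z = trans (card-insert (pair x y) z z∉xy) (cong suc (∣pair∣ x y x≢y))
  where
  z∉xy : lookup (pair x y) z ≡ false
  z∉xy = trans (lookup-update-other ⁅ x ⁆ true (λ z≡y → y≢z (sym z≡y)))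
               (∉-singleton x z (λ z≡x → x≢z (sym z≡x)))

sumOver : ∀ {m} → Subset m → (Fin m → Bool) → Bool
sumOver []      f = false
sumOver (b ∷ U) f = (b ∧ f zero) xor sumOver U (λ j → f (suc j))

sumCols-coord : ∀ {m n} (c : Fin m → GF2Vec n) U i → sumCols c U i ≡ sumOver U (λ j → c j i)
sumCols-coord c []      i = refl
sumCols-coord c (b ∷ U) i = cong ((b ∧ c zero i) xor_) (sumCols-coord (λ j → c (suc j)) U i)

sumOver-cong : ∀ {m} (U : Subset m) {f g : Fin m → Bool} →
  (∀ j → j ∈ᵇ U → f j ≡ g j) → sumOver U f ≡ sumOver U g
sumOver-cong []          h = refl
sumOver-cong (true  ∷ U) h = cong₂ _xor_ (h zero refl) (sumOver-cong U (λ j → h (suc j)))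
sumOver-cong (false ∷ U) h = sumOver-cong U (λ j → h (suc j))

sumOver-vanish : ∀ {m} (U : Subset m) {f : Fin m → Bool} →
  (∀ j → j ∈ᵇ U → f j ≡ false) → sumOver U f ≡ false
sumOver-vanish []          h = refl
sumOver-vanish (true  ∷ U) h rewrite h zero refl = sumOver-vanish U (λ j → h (suc j))
sumOver-vanish (false ∷ U) h = sumOver-vanish U (λ j → h (suc j))

sumOver-xor : ∀ {m} (U : Subset m) (f g : Fin m → Bool) →
  sumOver U (λ j → f j xor g j) ≡ sumOver U f xor sumOver U g
sumOver-xor []      f g = refl
sumOver-xor (b ∷ U) f g = begin
  (b ∧ (f zero xor g zero)) xor sumOver U (λ j → f (suc j) xor g (suc j))
    ≡⟨ cong₂ _xor_ (BP.∧-distribˡ-xor b (f zero) (g zero)) (sumOver-xor U _ _) ⟩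
  ((b ∧ f zero) xor (b ∧ g zero)) xor (sumOver U (λ j → f (suc j)) xor sumOver U (λ j → g (suc j)))
    ≡⟨ xor-interchange (b ∧ f zero) _ _ _ ⟩
  ((b ∧ f zero) xor sumOver U (λ j → f (suc j))) xor ((b ∧ g zero) xor sumOver U (λ j → g (suc j)))
    ∎
  where
  open ≡-Reasoning
  xor-interchange : ∀ a b c d → (a xor b) xor (c xor d) ≡ (a xor c) xor (b xor d)
  xor-interchange a b c d = begin
    (a xor b) xor (c xor d)  ≡⟨ BP.xor-assoc a b _ ⟩
    a xor (b xor (c xor d))  ≡⟨ cong (a xor_) (xor-leftComm b c d) ⟩
    a xor (c xor (b xor d))  ≡⟨ sym (BP.xor-assoc a c _) ⟩
    (a xor c) xor (b xor d)  ∎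

sumOver-scaleˡ : ∀ {m} (U : Subset m) k (f : Fin m → Bool) →
  sumOver U (λ j → k ∧ f j) ≡ k ∧ sumOver U f
sumOver-scaleˡ []      k f = sym (BP.∧-zeroʳ k)
sumOver-scaleˡ (b ∷ U) k f = begin
  (b ∧ (k ∧ f zero)) xor sumOver U (λ j → k ∧ f (suc j))
    ≡⟨ cong₂ _xor_ (∧-leftComm b k (f zero)) (sumOver-scaleˡ U k _) ⟩
  (k ∧ (b ∧ f zero)) xor (k ∧ sumOver U (λ j → f (suc j)))
    ≡⟨ sym (BP.∧-distribˡ-xor k _ _) ⟩
  k ∧ ((b ∧ f zero) xor sumOver U (λ j → f (suc j)))  ∎
  where
  open ≡-Reasoning
  ∧-leftComm : ∀ a b c → a ∧ (b ∧ c) ≡ b ∧ (a ∧ c)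
  ∧-leftComm a b c = trans (sym (BP.∧-assoc a b c))
                    (trans (cong (_∧ c) (BP.∧-comm a b)) (BP.∧-assoc b a c))

sumOver-scaleʳ : ∀ {m} (U : Subset m) k (f : Fin m → Bool) →
  sumOver U (λ j → f j ∧ k) ≡ sumOver U f ∧ k
sumOver-scaleʳ U k f = begin
  sumOver U (λ j → f j ∧ k)  ≡⟨ sumOver-cong U (λ j _ → BP.∧-comm (f j) k) ⟩
  sumOver U (λ j → k ∧ f j)  ≡⟨ sumOver-scaleˡ U k f ⟩
  k ∧ sumOver U f            ≡⟨ BP.∧-comm k _ ⟩
  sumOver U f ∧ k            ∎
  where open ≡-Reasoning

sumOver-swap : ∀ {m n} (g : Fin m → Fin n → Bool) (U : Subset n) (V : Subset m) →
  sumOver U (λ i → sumOver V (λ j → g j i)) ≡ sumOver V (λ j → sumOver U (λ i → g j i))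
sumOver-swap g []      V = sym (sumOver-vanish V (λ _ _ → refl))
sumOver-swap g (b ∷ U) V = begin
  (b ∧ sumOver V (λ j → g j zero)) xor sumOver U (λ i → sumOver V (λ j → g j (suc i)))
    ≡⟨ cong₂ _xor_ (sym (sumOver-scaleˡ V b _)) (sumOver-swap (λ j i → g j (suc i)) U V) ⟩
  sumOver V (λ j → b ∧ g j zero) xor sumOver V (λ j → sumOver U (λ i → g j (suc i)))
    ≡⟨ sym (sumOver-xor V _ _) ⟩
  sumOver V (λ j → (b ∧ g j zero) xor sumOver U (λ i → g j (suc i)))  ∎
  where open ≡-Reasoning

sumOver-update : ∀ {m} (U : Subset m) x b (f : Fin m → Bool) →
  sumOver (U [ x ]≔ b) f ≡ (b ∧ f x) xor sumOver (U [ x ]≔ false) f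
sumOver-update (a ∷ U) zero    b f = refl
sumOver-update (a ∷ U) (suc x) b f = begin
  (a ∧ f zero) xor sumOver (U [ x ]≔ b) (λ j → f (suc j))
    ≡⟨ cong ((a ∧ f zero) xor_) (sumOver-update U x b _) ⟩
  (a ∧ f zero) xor ((b ∧ f (suc x)) xor sumOver (U [ x ]≔ false) (λ j → f (suc j)))
    ≡⟨ xor-leftComm (a ∧ f zero) (b ∧ f (suc x)) _ ⟩
  (b ∧ f (suc x)) xor ((a ∧ f zero) xor sumOver (U [ x ]≔ false) (λ j → f (suc j)))  ∎
  where open ≡-Reasoning

sumOver-insert : ∀ {m} (U : Subset m) x b (f : Fin m → Bool) → lookup U x ≡ false →
  sumOver (U [ x ]≔ b) f ≡ (b ∧ f x) xor sumOver U f
sumOver-insert U x b f x∉U = trans (sumOver-update U x b f)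
  (cong (λ V → (b ∧ f x) xor sumOver V f) (subst (λ a → U [ x ]≔ a ≡ U) x∉U (VP.[]≔-lookup U x)))

sumOver-peel : ∀ {m} (U : Subset m) x (f : Fin m → Bool) →
  sumOver U f ≡ (lookup U x ∧ f x) xor sumOver (U [ x ]≔ false) f
sumOver-peel U x f = trans (cong (λ V → sumOver V f) (sym (VP.[]≔-lookup U x)))
                           (sumOver-update U x (lookup U x) f)

sumOver-point : ∀ {m} (U : Subset m) x (f : Fin m → Bool) →
  (∀ j → j ≢ x → j ∈ᵇ U → f j ≡ false) → sumOver U f ≡ lookup U x ∧ f x
sumOver-point U x f off = trans (sumOver-peel U x f)
  (trans (cong ((lookup U x ∧ f x) xor_) (sumOver-vanish (U [ x ]≔ false) rest))
         (BP.xor-identityʳ _))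
  where
  rest : ∀ j → j ∈ᵇ (U [ x ]≔ false) → f j ≡ false
  rest j j∈ = let (j≢x , j∈U) = ∈-remove⁻ U j j∈ in off j j≢x j∈U

sumOver-twoPoints : ∀ {m} (U : Subset m) x y (f : Fin m → Bool) → x ≢ y →
  (∀ j → j ≢ x → j ≢ y → j ∈ᵇ U → f j ≡ false) →
  sumOver U f ≡ (lookup U x ∧ f x) xor (lookup U y ∧ f y)
sumOver-twoPoints U x y f x≢y off = trans (sumOver-peel U x f)
  (cong ((lookup U x ∧ f x) xor_)
    (trans (sumOver-point (U [ x ]≔ false) y f rest)
           (cong (_∧ f y) (lookup-update-other U false (λ y≡x → x≢y (sym y≡x))))))
  where
  rest : ∀ j → j ≢ y → j ∈ᵇ (U [ x ]≔ false) → f j ≡ false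
  rest j j≢y j∈ = let (j≢x , j∈U) = ∈-remove⁻ U j j∈ in off j j≢x j≢y j∈U

sumOver-threePoints : ∀ {m} (U : Subset m) x y z (f : Fin m → Bool) → x ≢ y → x ≢ z → y ≢ z →
  (∀ j → j ≢ x → j ≢ y → j ≢ z → j ∈ᵇ U → f j ≡ false) →
  sumOver U f ≡ (lookup U x ∧ f x) xor ((lookup U y ∧ f y) xor (lookup U z ∧ f z))
sumOver-threePoints U x y z f x≢y x≢z y≢z off = trans (sumOver-peel U x f)
  (cong ((lookup U x ∧ f x) xor_)
    (trans (sumOver-twoPoints (U [ x ]≔ false) y z f y≢z rest)
           (cong₂ (λ a b → (a ∧ f y) xor (b ∧ f z))
                  (lookup-update-other U false (λ y≡x → x≢y (sym y≡x)))
                  (lookup-update-other U false (λ z≡x → x≢z (sym z≡x))))))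
  where
  rest : ∀ j → j ≢ y → j ≢ z → j ∈ᵇ (U [ x ]≔ false) → f j ≡ false
  rest j j≢y j≢z j∈ = let (j≢x , j∈U) = ∈-remove⁻ U j j∈ in off j j≢x j≢y j≢z j∈U

sumOver-indicator : ∀ {m} (U : Subset m) (f : Fin m → Bool) →
  sumOver ⊤ (λ j → lookup U j ∧ f j) ≡ sumOver U f
sumOver-indicator []      f = refl
sumOver-indicator (b ∷ U) f = cong ((b ∧ f zero) xor_) (sumOver-indicator U (λ j → f (suc j)))

ZeroSum : ∀ {m n} → (Fin m → GF2Vec n) → Subset m → Set
ZeroSum {n = n} c U = (i : Fin n) → sumOver U (λ j → c j i) ≡ false

record Dependency {m n} (c : Fin m → GF2Vec n) (T : Subset m) : Set where
  constructor dependency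
  field
    support   : Subset m
    support⊆T : support ⊆ᵇ T
    inhabited : Inhabited support
    zeroSum   : ZeroSum c support

Indep : ∀ {m n} → (Fin m → GF2Vec n) → Subset m → Set
Indep c T = ¬ Dependency c T

module _ {m n : ℕ} (c : Fin m → GF2Vec n) where

  private
    noDependencyOn : Subset m → Subset m → Bool
    noDependencyOn T U = not (subsetOf U T ∧ nonempty U ∧ isZeroVec (sumCols c U))

    dependency-of-test : ∀ T U → noDependencyOn T U ≡ false → Dependency c T
    dependency-of-test T U h =
      dependency U (subsetOf-sound U T (BP.∧-conicalˡ (subsetOf U T) _ all))
        (nonempty-sound U (BP.∧-conicalˡ (nonempty U) _ rest))
        (λ i → trans (sym (sumCols-coord c U i))
                     (isZeroVec-sound _ (BP.∧-conicalʳ (nonempty U) _ rest) i))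
      where
      all : (subsetOf U T ∧ nonempty U ∧ isZeroVec (sumCols c U)) ≡ true
      all = trans (sym (BP.not-involutive _)) (cong not h)
      rest : (nonempty U ∧ isZeroVec (sumCols c U)) ≡ true
      rest = BP.∧-conicalʳ (subsetOf U T) _ all

    test-of-dependency : ∀ T U → U ⊆ᵇ T → Inhabited U → ZeroSum c U → noDependencyOn T U ≡ false
    test-of-dependency T U U⊆T inh z
      rewrite subsetOf-complete U T U⊆T | nonempty-complete U inh
            | isZeroVec-complete (sumCols c U) (λ i → trans (sumCols-coord c U i) (z i)) = refl

  independent-sound : ∀ T → independent c T ≡ true → Indep c T
  independent-sound T h (dependency U U⊆T inh z) =
    true≢false (trans (sym (and-elim (noDependencyOn T) (allSubsets-complete U) h))
                      (test-of-dependency T U U⊆T inh z))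

  independent-complete : ∀ T → Indep c T → independent c T ≡ true
  independent-complete T ind = and-intro (noDependencyOn T) (allSubsets m) test
    where
    test : ∀ U → noDependencyOn T U ≡ true
    test U with noDependencyOn T U in h
    ... | true  = refl
    ... | false = ⊥-elim (ind (dependency-of-test T U h))

  indep-or-dependency : ∀ T → Indep c T ⊎ Dependency c T
  indep-or-dependency T with independent c T in h
  ... | true  = inj₁ (independent-sound T h)
  ... | false = inj₂ (let (U , e) = and-counterexample (noDependencyOn T) (allSubsets m) h
                      in dependency-of-test T U e)

maxList-upper : ∀ {A : Set} (g : A → ℕ) {xs x} → x ∈ xs → g x ≤ maxList (map g xs)
maxList-upper g {y ∷ _} (here refl)  = NP.m≤m⊔n (g y) _
maxList-upper g {y ∷ _} (there x∈xs) = NP.≤-trans (maxList-upper g x∈xs) (NP.m≤n⊔m (g y) _)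

maxList-least : ∀ {A : Set} (g : A → ℕ) xs k → (∀ x → g x ≤ k) → maxList (map g xs) ≤ k
maxList-least g []       k h = z≤n
maxList-least g (x ∷ xs) k h = NP.⊔-lub (h x) (maxList-least g xs k h)

maxList-attained : ∀ {A : Set} (g : A → ℕ) xs →
  maxList (map g xs) ≡ 0 ⊎ Σ A (λ x → maxList (map g xs) ≡ g x)
maxList-attained g [] = inj₁ refl
maxList-attained g (x ∷ xs) with NP.⊔-sel (g x) (maxList (map g xs))
... | inj₁ e = inj₂ (x , e)
... | inj₂ e with maxList-attained g xs
...   | inj₁ e′       = inj₁ (trans e e′)
...   | inj₂ (y , e′) = inj₂ (y , trans e e′)

module _ {m n : ℕ} (c : Fin m → GF2Vec n) where

  private
    candidate : Subset m → Subset m → ℕ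
    candidate S T = if subsetOf T S ∧ independent c T then ∣ T ∣ else 0

    ∉∅ : ∀ j → lookup (∅ {m}) j ≡ false
    ∉∅ j = VP.lookup-replicate j false

    empty-basis : ∀ S → rank c S ≡ 0 → Σ (Subset m) λ T → T ⊆ᵇ S × Indep c T × ∣ T ∣ ≡ rank c S
    empty-basis S r≡0 =
      ∅ , (λ j j∈∅ → ⊥-elim (true≢false (trans (sym j∈∅) (∉∅ j))))
        , (λ { (dependency U U⊆∅ (j , j∈U) _) → true≢false (trans (sym (U⊆∅ j j∈U)) (∉∅ j)) })
        , trans (SP.∣⊥∣≡0 m) (sym r≡0)

  rank-lower : ∀ S T → T ⊆ᵇ S → Indep c T → ∣ T ∣ ≤ rank c S
  rank-lower S T T⊆S ind
    with maxList-upper (candidate S) (allSubsets-complete T)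
  ... | bound rewrite subsetOf-complete T S T⊆S | independent-complete c T ind = bound

  rank-upper : ∀ S k → (∀ T → T ⊆ᵇ S → Indep c T → ∣ T ∣ ≤ k) → rank c S ≤ k
  rank-upper S k h = maxList-least (candidate S) (allSubsets m) k bounded
    where
    bounded : ∀ T → candidate S T ≤ k
    bounded T with subsetOf T S in T⊆S | independent c T in ind
    ... | true  | true  = h T (subsetOf-sound T S T⊆S) (independent-sound c T ind)
    ... | true  | false = z≤n
    ... | false | _     = z≤n

  rank-basis : ∀ S → Σ (Subset m) λ T → T ⊆ᵇ S × Indep c T × ∣ T ∣ ≡ rank c S
  rank-basis S with maxList-attained (candidate S) (allSubsets m)
  ... | inj₁ r≡0 = empty-basis S r≡0
  ... | inj₂ (T , r≡) with subsetOf T S in T⊆S | independent c T in ind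
  ...   | true  | true  = T , subsetOf-sound T S T⊆S , independent-sound c T ind , sym r≡
  ...   | true  | false = empty-basis S r≡
  ...   | false | _     = empty-basis S r≡

  rank-mono : ∀ S S′ → S ⊆ᵇ S′ → rank c S ≤ rank c S′
  rank-mono S S′ S⊆S′ =
    rank-upper S _ (λ T T⊆S ind → rank-lower S′ T (λ j j∈T → S⊆S′ j (T⊆S j j∈T)) ind)

-- The dimension bound: independent vectors supported on the coordinate set R
-- number at most |R|.  Proof by Gaussian elimination on the first coordinate.

SupportedOn : ∀ {m n} → (Fin m → GF2Vec n) → Subset m → Subset n → Set
SupportedOn c T R = ∀ j i → j ∈ᵇ T → lookup R i ≡ false → c j i ≡ false

tailCoords : ∀ {m n} → (Fin m → GF2Vec (suc n)) → Fin m → GF2Vec n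
tailCoords c j i = c j (suc i)

indep-tail : ∀ {m n} (c : Fin m → GF2Vec (suc n)) T →
  (∀ j → j ∈ᵇ T → c j zero ≡ false) → Indep c T → Indep (tailCoords c) T
indep-tail c T zero-on-T ind (dependency U U⊆T inh z) = ind (dependency U U⊆T inh z′)
  where
  z′ : ZeroSum c U
  z′ zero    = sumOver-vanish U (λ j j∈U → zero-on-T j (U⊆T j j∈U))
  z′ (suc i) = z i

eliminate : ∀ {m n} → (Fin m → GF2Vec (suc n)) → Fin m → Fin m → GF2Vec n
eliminate c p j i = c j (suc i) xor (c j zero ∧ c p (suc i))

-- elimination keeps the remaining columns of T independent: a dependency
-- among them lifts to one among the original columns, with the pivot added
-- exactly when needed to clear the first coordinate
indep-eliminate : ∀ {m n} (c : Fin m → GF2Vec (suc n)) T p → p ∈ᵇ T → c p zero ≡ true →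
  Indep c T → Indep (eliminate c p) (T [ p ]≔ false)
indep-eliminate c T p p∈T pivot ind (dependency U U⊆T′ (j , j∈U) z) =
  ind (dependency U′ U′⊆T (j , j∈U′) z′)
  where
  β : Bool
  β = sumOver U (λ k → c k zero)
  U′ : Subset _
  U′ = U [ p ]≔ β
  p∉U : lookup U p ≡ false
  p∉U = ≢true⇒false (λ p∈U → proj₁ (∈-remove⁻ T p (U⊆T′ p p∈U)) refl)
  U′⊆T : U′ ⊆ᵇ T
  U′⊆T k k∈U′ with k ≟ p
  ... | yes refl = p∈T
  ... | no  k≢p  = proj₂ (∈-remove⁻ T k (U⊆T′ k (trans (sym (lookup-update-other U β k≢p)) k∈U′)))
  j∈U′ : j ∈ᵇ U′
  j∈U′ = trans (lookup-update-other U β (proj₁ (∈-remove⁻ T j (U⊆T′ j j∈U)))) j∈U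
  open ≡-Reasoning
  z′ : ZeroSum c U′
  z′ zero = begin
    sumOver U′ (λ k → c k zero)  ≡⟨ sumOver-insert U p β _ p∉U ⟩
    (β ∧ c p zero) xor β         ≡⟨ cong (λ x → (β ∧ x) xor β) pivot ⟩
    (β ∧ true) xor β             ≡⟨ cong (_xor β) (BP.∧-identityʳ β) ⟩
    β xor β                      ≡⟨ BP.xor-same β ⟩
    false                        ∎
  z′ (suc i) = begin
    sumOver U′ (λ k → c k (suc i))
      ≡⟨ sumOver-insert U p β _ p∉U ⟩
    (β ∧ c p (suc i)) xor sumOver U (λ k → c k (suc i))
      ≡⟨ BP.xor-comm (β ∧ c p (suc i)) _ ⟩
    sumOver U (λ k → c k (suc i)) xor (β ∧ c p (suc i))
      ≡⟨ cong (sumOver U (λ k → c k (suc i)) xor_) (sym (sumOver-scaleʳ U (c p (suc i)) _)) ⟩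
    sumOver U (λ k → c k (suc i)) xor sumOver U (λ k → c k zero ∧ c p (suc i))
      ≡⟨ sym (sumOver-xor U _ _) ⟩
    sumOver U (λ k → eliminate c p k i)
      ≡⟨ z i ⟩
    false  ∎

supported-eliminate : ∀ {m n} (c : Fin m → GF2Vec (suc n)) T R p →
  SupportedOn c T (true ∷ R) → p ∈ᵇ T → SupportedOn (eliminate c p) (T [ p ]≔ false) R
supported-eliminate c T R p sup p∈T j i j∈T′ i∉R
  rewrite sup j (suc i) (proj₂ (∈-remove⁻ T j j∈T′)) i∉R | sup p (suc i) p∈T i∉R =
  BP.∧-zeroʳ (c j zero)

indep-size-bound : ∀ n {m} (c : Fin m → GF2Vec n) (R : Subset n) (T : Subset m) →
  SupportedOn c T R → Indep c T → ∣ T ∣ ≤ ∣ R ∣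
indep-size-bound zero c [] T _ ind with empty-or-inhabited T
... | inj₁ ∣T∣≡0 = NP.≤-reflexive ∣T∣≡0
... | inj₂ inh   = ⊥-elim (ind (dependency T (λ _ j∈T → j∈T) inh (λ ())))
indep-size-bound (suc n) c (false ∷ R) T sup ind =
  indep-size-bound n (tailCoords c) R T (λ j i → sup j (suc i))
    (indep-tail c T (λ j j∈T → sup j zero j∈T refl) ind)
indep-size-bound (suc n) c (true ∷ R) T sup ind
  with FP.any? (λ j → (lookup T j BP.≟ true) ×-dec (c j zero BP.≟ true))
... | no noPivot =
  NP.m≤n⇒m≤1+n (indep-size-bound n (tailCoords c) R T (λ j i → sup j (suc i))
    (indep-tail c T (λ j j∈T → ≢true⇒false (λ c≡1 → noPivot (j , j∈T , c≡1))) ind))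
... | yes (p , p∈T , pivot) = begin
  ∣ T ∣                   ≡⟨ card-remove T p p∈T ⟩
  suc ∣ T [ p ]≔ false ∣  ≤⟨ s≤s (indep-size-bound n (eliminate c p) R (T [ p ]≔ false)
                                   (supported-eliminate c T R p sup p∈T)
                                   (indep-eliminate c T p p∈T pivot ind)) ⟩
  suc ∣ R ∣               ∎
  where open NP.≤-Reasoning

-- Functionals.  U ∈ GF(2)^n (as a subset of coordinates) annihilates the
-- columns of S when Σ_{i ∈ U} c_e i = 0 for every e ∈ S.

module _ {m n : ℕ} (c : Fin m → GF2Vec n) where

  Annihilates : Subset n → Subset m → Set
  Annihilates U S = ∀ e → e ∈ᵇ S → sumOver U (c e) ≡ false

  rank-≤-dim : ∀ S → rank c S ≤ n
  rank-≤-dim S = rank-upper c S n λ T _ ind →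
    subst (∣ T ∣ ≤_) (SP.∣⊤∣≡n n)
      (indep-size-bound n c ⊤ T (λ j i _ i∉⊤ → ⊥-elim (true≢false
          (trans (sym (VP.lookup-replicate i true)) i∉⊤))) ind)

  -- any set of fewer than n columns is annihilated by a nonzero functional:
  -- the n rows of the columns of T are vectors supported on T, hence dependent
  small-set-annihilator : ∀ T → ∣ T ∣ < n → Σ (Subset n) λ U → Inhabited U × Annihilates U T
  small-set-annihilator T ∣T∣<n with indep-or-dependency rows ⊤
    where
    rows : Fin n → GF2Vec m
    rows i j = lookup T j ∧ c j i
  ... | inj₁ ind = ⊥-elim (NP.<⇒≱ ∣T∣<n (subst (_≤ ∣ T ∣) (SP.∣⊤∣≡n n)
          (indep-size-bound m _ T ⊤ (λ i j _ j∉T → cong (_∧ c j i) j∉T) ind)))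
  ... | inj₂ (dependency U _ inh z) = U , inh , λ j j∈T →
          trans (sumOver-cong U (λ i _ → cong (_∧ c j i) (sym j∈T))) (z j)

  InSpan : Subset m → GF2Vec n → Set
  InSpan T v = Σ (Subset m) λ V → V ⊆ᵇ T × (∀ i → v i ≡ sumOver V (λ j → c j i))

  annihilates-span : ∀ U T {v} → Annihilates U T → InSpan T v → sumOver U v ≡ false
  annihilates-span U T {v} ann (V , V⊆T , v≡) = begin
    sumOver U v                                ≡⟨ sumOver-cong U (λ i _ → v≡ i) ⟩
    sumOver U (λ i → sumOver V (λ j → c j i))  ≡⟨ sumOver-swap (λ j i → c j i) U V ⟩
    sumOver V (λ j → sumOver U (c j))          ≡⟨ sumOver-vanish V (λ j j∈V → ann j (V⊆T j j∈V)) ⟩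
    false                                      ∎
    where open ≡-Reasoning

  -- a basis T of S spans every column of S: adding e ∉ T gives a dependent
  -- set, and the dependency must use e
  basis-spans : ∀ S T e → T ⊆ᵇ S → Indep c T → ∣ T ∣ ≡ rank c S →
    e ∈ᵇ S → lookup T e ≡ false → InSpan T (c e)
  basis-spans S T e T⊆S indT ∣T∣≡r e∈S e∉T with indep-or-dependency c (T [ e ]≔ true)
  ... | inj₁ indT+e = ⊥-elim (NP.1+n≰n (begin
        suc ∣ T ∣             ≡⟨ sym (card-insert T e e∉T) ⟩
        ∣ T [ e ]≔ true ∣     ≤⟨ rank-lower c S _ T+e⊆S indT+e ⟩
        rank c S              ≡⟨ sym ∣T∣≡r ⟩
        ∣ T ∣                 ∎))
    where
    open NP.≤-Reasoning
    T+e⊆S : (T [ e ]≔ true) ⊆ᵇ S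
    T+e⊆S j j∈ with ∈-insert⁻ T j j∈
    ... | inj₁ refl = e∈S
    ... | inj₂ j∈T  = T⊆S j j∈T
  ... | inj₂ (dependency V V⊆T+e inh z) with lookup V e in e∈?V
  ...   | false = ⊥-elim (indT (dependency V V⊆T inh z))
    where
    V⊆T : V ⊆ᵇ T
    V⊆T j j∈V with ∈-insert⁻ T j (V⊆T+e j j∈V)
    ... | inj₁ refl = ⊥-elim (true≢false (trans (sym j∈V) e∈?V))
    ... | inj₂ j∈T  = j∈T
  ...   | true = V [ e ]≔ false , V′⊆T , λ i →
            xor≡false⇒≡ (trans (sym (peel i)) (z i))
    where
    peel : ∀ i → sumOver V (λ j → c j i) ≡ c e i xor sumOver (V [ e ]≔ false) (λ j → c j i)
    peel i = trans (sumOver-peel V e (λ j → c j i))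
                   (cong (λ b → (b ∧ c e i) xor sumOver (V [ e ]≔ false) (λ j → c j i)) e∈?V)
    V′⊆T : (V [ e ]≔ false) ⊆ᵇ T
    V′⊆T j j∈V′ with ∈-remove⁻ V j j∈V′
    ... | j≢e , j∈V with ∈-insert⁻ T j (V⊆T+e j j∈V)
    ...   | inj₁ j≡e = ⊥-elim (j≢e j≡e)
    ...   | inj₂ j∈T = j∈T

  annihilator : ∀ S → rank c S < n → Σ (Subset n) λ U → Inhabited U × Annihilates U S
  annihilator S r<n with rank-basis c S
  ... | T , T⊆S , indT , ∣T∣≡r with small-set-annihilator T (subst (_< n) (sym ∣T∣≡r) r<n)
  ...   | U , inh , annT = U , inh , annS
    where
    annS : Annihilates U S
    annS e e∈S with lookup T e in e∈?T
    ... | true  = annT e e∈?T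
    ... | false = annihilates-span U T annT (basis-spans S T e T⊆S indT ∣T∣≡r e∈S e∈?T)

module _ {m n : ℕ} (c : Fin m → GF2Vec n) where

  -- λ(X) ≤ r(X), since r(W − X) ≤ r(M)
  conn-≤-rank : ∀ X → conn c X ≤ rank c X
  conn-≤-rank X = begin
    (rank c X + rank c (∁ X)) ∸ rank c ⊤
      ≤⟨ NP.∸-monoˡ-≤ (rank c ⊤) (NP.+-monoʳ-≤ (rank c X)
           (rank-mono c (∁ X) ⊤ (λ j _ → VP.lookup-replicate j true))) ⟩
    (rank c X + rank c ⊤) ∸ rank c ⊤
      ≡⟨ NP.m+n∸n≡m (rank c X) (rank c ⊤) ⟩
    rank c X  ∎
    where open NP.≤-Reasoning

  low-rank-separation : ∀ k X → rank c X < k → k ≤ ∣ X ∣ → k ≤ m ∸ ∣ X ∣ → IsSeparation c k X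
  low-rank-separation k X r<k k≤∣X∣ k≤∣∁X∣ =
    NP.≤-<-trans (conn-≤-rank X) r<k , k≤∣X∣ , subst (k ≤_) (sym (SP.∣∁p∣≡n∸∣p∣ X)) k≤∣∁X∣

  rank-loop : ∀ e → (∀ i → c e i ≡ false) → rank c ⁅ e ⁆ ≤ 0
  rank-loop e c≡0 = rank-upper c ⁅ e ⁆ 0 λ T T⊆e ind → empty-or-dependent T T⊆e ind (empty-or-inhabited T)
    where
    empty-or-dependent : ∀ T → T ⊆ᵇ ⁅ e ⁆ → Indep c T → ∣ T ∣ ≡ 0 ⊎ Inhabited T → ∣ T ∣ ≤ 0
    empty-or-dependent T _   _   (inj₁ ∣T∣≡0) = NP.≤-reflexive ∣T∣≡0
    empty-or-dependent T T⊆e ind (inj₂ inh)   = ⊥-elim (ind (dependency T (λ _ j∈T → j∈T) inh λ i →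
      sumOver-vanish T λ j j∈T → subst (λ x → c x i ≡ false) (sym (∈-singleton⁻ e j (T⊆e j j∈T))) (c≡0 i)))

  rank-parallel : ∀ e f → e ≢ f → (∀ i → c e i ≡ c f i) → rank c (pair e f) ≤ 1
  rank-parallel e f e≢f c≡ = rank-upper c (pair e f) 1 bound
    where
    bound : ∀ T → T ⊆ᵇ pair e f → Indep c T → ∣ T ∣ ≤ 1
    bound T T⊆ef ind with lookup T e in e∈? | lookup T f in f∈?
    ... | true | true = ⊥-elim (ind (dependency T (λ _ j∈T → j∈T) (e , e∈?) λ i →
          trans (sumOver-twoPoints T e f (λ j → c j i) e≢f (off i))
                (trans (cong₂ (λ a b → (a ∧ c e i) xor (b ∧ c f i)) e∈? f∈?)
                       (trans (cong (_xor c f i) (c≡ i)) (BP.xor-same (c f i))))))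
      where
      off : ∀ i j → j ≢ e → j ≢ f → j ∈ᵇ T → c j i ≡ false
      off i j j≢e j≢f j∈T with ∈-pair⁻ e f j (T⊆ef j j∈T)
      ... | inj₁ j≡e = ⊥-elim (j≢e j≡e)
      ... | inj₂ j≡f = ⊥-elim (j≢f j≡f)
    ... | false | _ = card-≤1 T f only-f
      where
      only-f : ∀ j → j ∈ᵇ T → j ≡ f
      only-f j j∈T with ∈-pair⁻ e f j (T⊆ef j j∈T)
      ... | inj₁ refl = ⊥-elim (true≢false (trans (sym j∈T) e∈?))
      ... | inj₂ j≡f  = j≡f
    ... | true | false = card-≤1 T e only-e
      where
      only-e : ∀ j → j ∈ᵇ T → j ≡ e
      only-e j j∈T with ∈-pair⁻ e f j (T⊆ef j j∈T)
      ... | inj₁ j≡e  = j≡e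
      ... | inj₂ refl = ⊥-elim (true≢false (trans (sym j∈T) f∈?))

  -- {e} with c_e = 0 would be a 1-separation
  no-loop : ThreeConnected c → 2 ≤ m → ∀ e → ¬ (∀ i → c e i ≡ false)
  no-loop tc 2≤m e c≡0 = proj₁ (tc ⁅ e ⁆)
    (low-rank-separation 1 ⁅ e ⁆ (s≤s (rank-loop e c≡0))
      (NP.≤-reflexive (sym (SP.∣⁅x⁆∣≡1 e)))
      (subst (λ k → 1 ≤ m ∸ k) (sym (SP.∣⁅x⁆∣≡1 e)) (NP.∸-monoˡ-≤ 1 2≤m)))

  -- {e, f} with c_e = c_f would be a 2-separation
  no-parallel : ThreeConnected c → 4 ≤ m → ∀ e f → e ≢ f → ¬ (∀ i → c e i ≡ c f i)
  no-parallel tc 4≤m e f e≢f c≡ = proj₂ (tc (pair e f))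
    (low-rank-separation 2 (pair e f) (s≤s (rank-parallel e f e≢f c≡))
      (NP.≤-reflexive (sym (∣pair∣ e f e≢f)))
      (subst (λ k → 2 ≤ m ∸ k) (sym (∣pair∣ e f e≢f)) (NP.∸-monoˡ-≤ 2 4≤m)))

  no-short-combination : ThreeConnected c → 4 ≤ m → ∀ x y → x ≢ y → ∀ p q →
    p ≡ true ⊎ q ≡ true → ¬ (∀ i → (p ∧ c x i) xor (q ∧ c y i) ≡ false)
  no-short-combination tc 4≤m x y x≢y true true _ z =
    no-parallel tc 4≤m x y x≢y (λ i → xor≡false⇒≡ (z i))
  no-short-combination tc 4≤m x y x≢y true false _ z =
    no-loop tc (NP.≤-trans (s≤s (s≤s z≤n)) 4≤m) x (λ i → trans (sym (BP.xor-identityʳ (c x i))) (z i))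
  no-short-combination tc 4≤m x y x≢y false true _ z =
    no-loop tc (NP.≤-trans (s≤s (s≤s z≤n)) 4≤m) y z
  no-short-combination tc 4≤m x y x≢y false false (inj₁ ()) _
  no-short-combination tc 4≤m x y x≢y false false (inj₂ ()) _

  no-small-dependency : ThreeConnected c → 4 ≤ m → ∀ x y → x ≢ y → ∀ U →
    (∀ j → j ∈ᵇ U → j ≡ x ⊎ j ≡ y) → Inhabited U → ¬ ZeroSum c U
  no-small-dependency tc 4≤m x y x≢y U on-xy (j , j∈U) z =
    no-short-combination tc 4≤m x y x≢y (lookup U x) (lookup U y) x∨y λ i →
      trans (sym (sumOver-twoPoints U x y (λ j → c j i) x≢y (off i))) (z i)
    where
    x∨y : lookup U x ≡ true ⊎ lookup U y ≡ true
    x∨y with on-xy j j∈U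
    ... | inj₁ refl = inj₁ j∈U
    ... | inj₂ refl = inj₂ j∈U
    off : ∀ i k → k ≢ x → k ≢ y → k ∈ᵇ U → c k i ≡ false
    off i k k≢x k≢y k∈U with on-xy k k∈U
    ... | inj₁ k≡x = ⊥-elim (k≢x k≡x)
    ... | inj₂ k≡y = ⊥-elim (k≢y k≡y)

  independent-or-triangle : ThreeConnected c → 4 ≤ m → ∀ S x y z → x ≢ y → x ≢ z → y ≢ z →
    x ∈ᵇ S → y ∈ᵇ S → z ∈ᵇ S → 3 ≤ rank c S ⊎ (∀ i → c x i xor (c y i xor c z i) ≡ false)
  independent-or-triangle tc 4≤m S x y z x≢y x≢z y≢z x∈S y∈S z∈S
    with indep-or-dependency c (triple x y z)
  ... | inj₁ ind = inj₁ (subst (_≤ rank c S) (∣triple∣ x y z x≢y x≢z y≢z)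
                          (rank-lower c S (triple x y z) xyz⊆S ind))
    where
    xyz⊆S : triple x y z ⊆ᵇ S
    xyz⊆S j j∈ with ∈-triple⁻ x y z j j∈
    ... | inj₁ refl        = x∈S
    ... | inj₂ (inj₁ refl) = y∈S
    ... | inj₂ (inj₂ refl) = z∈S
  ... | inj₂ (dependency U U⊆xyz inh zero-sum)
    with lookup U x in x∈? | lookup U y in y∈? | lookup U z in z∈?
  ...   | true  | true  | true  = inj₂ λ i → trans (sym (evaluate i)) (zero-sum i)
    where
    off : ∀ i j → j ≢ x → j ≢ y → j ≢ z → j ∈ᵇ U → c j i ≡ false
    off i j j≢x j≢y j≢z j∈U with ∈-triple⁻ x y z j (U⊆xyz j j∈U)
    ... | inj₁ refl        = ⊥-elim (j≢x refl)
    ... | inj₂ (inj₁ refl) = ⊥-elim (j≢y refl)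
    ... | inj₂ (inj₂ refl) = ⊥-elim (j≢z refl)
    evaluate : ∀ i → sumOver U (λ j → c j i) ≡ c x i xor (c y i xor c z i)
    evaluate i = trans (sumOver-threePoints U x y z (λ j → c j i) x≢y x≢z y≢z (off i))
      (cong₂ (λ a bc → (a ∧ c x i) xor bc) x∈?
        (cong₂ (λ b d → (b ∧ c y i) xor (d ∧ c z i)) y∈? z∈?))
  ...   | false | _     | _     = ⊥-elim (no-small-dependency tc 4≤m y z y≢z U on-yz inh zero-sum)
    where
    on-yz : ∀ j → j ∈ᵇ U → j ≡ y ⊎ j ≡ z
    on-yz j j∈U with ∈-triple⁻ x y z j (U⊆xyz j j∈U)
    ... | inj₁ refl = ⊥-elim (true≢false (trans (sym j∈U) x∈?))
    ... | inj₂ r    = r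
  ...   | true  | false | _     = ⊥-elim (no-small-dependency tc 4≤m x z x≢z U on-xz inh zero-sum)
    where
    on-xz : ∀ j → j ∈ᵇ U → j ≡ x ⊎ j ≡ z
    on-xz j j∈U with ∈-triple⁻ x y z j (U⊆xyz j j∈U)
    ... | inj₁ j≡x         = inj₁ j≡x
    ... | inj₂ (inj₁ refl) = ⊥-elim (true≢false (trans (sym j∈U) y∈?))
    ... | inj₂ (inj₂ j≡z)  = inj₂ j≡z
  ...   | true  | true  | false = ⊥-elim (no-small-dependency tc 4≤m x y x≢y U on-xy inh zero-sum)
    where
    on-xy : ∀ j → j ∈ᵇ U → j ≡ x ⊎ j ≡ y
    on-xy j j∈U with ∈-triple⁻ x y z j (U⊆xyz j j∈U)
    ... | inj₁ j≡x         = inj₁ j≡x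
    ... | inj₂ (inj₁ j≡y)  = inj₂ j≡y
    ... | inj₂ (inj₂ refl) = ⊥-elim (true≢false (trans (sym j∈U) z∈?))

  -- Part 1, for any 3-connected binary matroid: four elements a, b, d, d' of
  -- S give r(S) ≥ 3, for otherwise abd and abd' are triangles and d ∥ d'
  rank-≥3 : ThreeConnected c → ∀ S → 4 ≤ ∣ S ∣ → 3 ≤ rank c S
  rank-≥3 tc S 4≤∣S∣ with NP.≤-trans 4≤∣S∣ (SP.∣p∣≤n S) | distinct-members S 4 4≤∣S∣
  ... | 4≤m | a ∷ b ∷ d ∷ d′ ∷ [] , _
      , (a≢b ∷ a≢d ∷ a≢d′ ∷ []) ∷ (b≢d ∷ b≢d′ ∷ []) ∷ (d≢d′ ∷ []) ∷ [] ∷ []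
      , a∈S ∷ b∈S ∷ d∈S ∷ d′∈S ∷ []
    with independent-or-triangle tc 4≤m S a b d a≢b a≢d b≢d a∈S b∈S d∈S
       | independent-or-triangle tc 4≤m S a b d′ a≢b a≢d′ b≢d′ a∈S b∈S d′∈S
  ...   | inj₁ r   | _         = r
  ...   | inj₂ _   | inj₁ r    = r
  ...   | inj₂ abd | inj₂ abd′ =
    ⊥-elim (no-parallel tc 4≤m d d′ d≢d′ (λ i → xor-cancel (c a i) (c b i) _ _ (abd i) (abd′ i)))

-- The columns of IAS(G).  Each vertex v owns three columns, e_v, A_v and
-- A_v + e_v; the column of kind k is coefA k · A_v + coefI k · e_v.

data Kind : Set where
  ident adj adj+ident : Kind

coefA coefI : Kind → Bool
coefA ident     = false
coefA adj       = true
coefA adj+ident = true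
coefI ident     = true
coefI adj       = false
coefI adj+ident = true

kind-with : ∀ p q → p ∨ q ≡ true → Σ Kind λ k → coefA k ≡ p × coefI k ≡ q
kind-with true  true  _ = adj+ident , refl , refl
kind-with true  false _ = adj , refl , refl
kind-with false true  _ = ident , refl , refl

two-kinds-valued-one : ∀ u a → u ∨ a ≡ true → Σ Kind λ k → Σ Kind λ k′ → k ≢ k′ ×
  (coefA k ∧ a) xor (coefI k ∧ u) ≡ true × (coefA k′ ∧ a) xor (coefI k′ ∧ u) ≡ true
two-kinds-valued-one true  true  _ = ident , adj       , (λ ()) , refl , refl
two-kinds-valued-one true  false _ = ident , adj+ident , (λ ()) , refl , refl
two-kinds-valued-one false true  _ = adj   , adj+ident , (λ ()) , refl , refl

δ-refl : ∀ {n} (i : Fin n) → δ i i ≡ true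
δ-refl i = trans (isYes≗does (i ≟ i)) (dec-true (i ≟ i) refl)

δ-≢ : ∀ {n} {i j : Fin n} → i ≢ j → δ i j ≡ false
δ-≢ {i = i} {j} i≢j = trans (isYes≗does (i ≟ j)) (dec-false (i ≟ j) i≢j)

two-vertices : ∀ {n} (u w : Fin n) → u ≢ w → 2 ≤ n
two-vertices {suc (suc _)} _    _    _   = s≤s (s≤s z≤n)
two-vertices {suc zero}    zero zero u≢w = ⊥-elim (u≢w refl)

double-≤-W : ∀ {k n} → k ≤ n → k + k ≤ W n
double-≤-W {n = n} k≤n = NP.≤-trans (NP.+-mono-≤ k≤n k≤n) (NP.m≤m+n (n + n) n)

module Columns {n : ℕ} (A : Graph n) where

  combo : Bool → Bool → Fin n → GF2Vec n
  combo p q v i = (p ∧ A i v) xor (q ∧ δ i v)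

  col : Kind → Fin n → Fin (W n)
  col ident     v = (v ↑ˡ n) ↑ˡ n
  col adj       v = (n ↑ʳ v) ↑ˡ n
  col adj+ident v = (n + n) ↑ʳ v

  IAS-col : ∀ k v i → IAS A (col k v) i ≡ combo (coefA k) (coefI k) v i
  IAS-col ident v i
    rewrite FP.splitAt-↑ˡ (n + n) (v ↑ˡ n) n | FP.splitAt-↑ˡ n v n = refl
  IAS-col adj v i
    rewrite FP.splitAt-↑ˡ (n + n) (n ↑ʳ v) n | FP.splitAt-↑ʳ n n v = sym (BP.xor-identityʳ (A i v))
  IAS-col adj+ident v i
    rewrite FP.splitAt-↑ʳ (n + n) n v = refl

  decode : Fin (W n) → Kind × Fin n
  decode x with splitAt (n + n) x
  ... | inj₂ v = adj+ident , v
  ... | inj₁ y with splitAt n y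
  ...   | inj₁ v = ident , v
  ...   | inj₂ v = adj , v

  decode-col : ∀ k v → decode (col k v) ≡ (k , v)
  decode-col ident v
    rewrite FP.splitAt-↑ˡ (n + n) (v ↑ˡ n) n | FP.splitAt-↑ˡ n v n = refl
  decode-col adj v
    rewrite FP.splitAt-↑ˡ (n + n) (n ↑ʳ v) n | FP.splitAt-↑ʳ n n v = refl
  decode-col adj+ident v
    rewrite FP.splitAt-↑ʳ (n + n) n v = refl

  col-injective : ∀ {k k′ v v′} → col k v ≡ col k′ v′ → (k , v) ≡ (k′ , v′)
  col-injective {k} {k′} {v} {v′} eq =
    trans (sym (decode-col k v)) (trans (cong decode eq) (decode-col k′ v′))

  cols-of-vertices-apart : ∀ {k k′ v w} → v ≢ w → col k v ≢ col k′ w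
  cols-of-vertices-apart {k} {k′} {v} {w} v≢w eq = v≢w (cong proj₂ (col-injective {k} {k′} {v} {w} eq))

  cols-of-kinds-apart : ∀ {k k′ v} → k ≢ k′ → col k v ≢ col k′ v
  cols-of-kinds-apart {k} {k′} {v} k≢k′ eq = k≢k′ (cong proj₁ (col-injective {k} {k′} {v} {v} eq))

module NoAnnihilator {n : ℕ} (A : Graph n) (symA : Symmetric A) (tc : ThreeConnected (IAS A))
  (S : Subset (W n)) (few-outside : ∣ ∁ S ∣ ≤ 5)
  (U : Subset n) (annihilates : Annihilates (IAS A) U S) where

  open Columns A

  a : Fin n → Bool
  a v = sumOver U (λ i → A i v)

  value-e : ∀ v → sumOver U (λ i → δ i v) ≡ lookup U v
  value-e v = trans (sumOver-point U v (λ i → δ i v) (λ i i≢v _ → δ-≢ i≢v))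
                    (trans (cong (lookup U v ∧_) (δ-refl v)) (BP.∧-identityʳ (lookup U v)))

  value-combo : ∀ p q v → sumOver U (combo p q v) ≡ (p ∧ a v) xor (q ∧ lookup U v)
  value-combo p q v = begin
    sumOver U (combo p q v)
      ≡⟨ sumOver-xor U (λ i → p ∧ A i v) (λ i → q ∧ δ i v) ⟩
    sumOver U (λ i → p ∧ A i v) xor sumOver U (λ i → q ∧ δ i v)
      ≡⟨ cong₂ _xor_ (sumOver-scaleˡ U p _) (sumOver-scaleˡ U q _) ⟩
    (p ∧ a v) xor (q ∧ sumOver U (λ i → δ i v))
      ≡⟨ cong (λ x → (p ∧ a v) xor (q ∧ x)) (value-e v) ⟩
    (p ∧ a v) xor (q ∧ lookup U v)  ∎
    where open ≡-Reasoning

  outside : ∀ e → sumOver U (IAS A e) ≡ true → e ∈ᵇ ∁ S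
  outside e value≡1 with lookup S e in e∈?S
  ... | true  = ⊥-elim (true≢false (trans (sym value≡1) (annihilates e e∈?S)))
  ... | false = trans (VP.lookup-map e not S) (cong not e∈?S)

  active : Fin n → Bool
  active v = lookup U v ∨ a v

  record TwoOutside (v : Fin n) : Set where
    field
      k k′   : Kind
      k≢k′   : k ≢ k′
      out    : col k v ∈ᵇ ∁ S
      out′   : col k′ v ∈ᵇ ∁ S

  two-outside : ∀ v → active v ≡ true → TwoOutside v
  two-outside v act with two-kinds-valued-one (lookup U v) (a v) act
  ... | k , k′ , k≢k′ , one , one′ = record
    { k = k ; k′ = k′ ; k≢k′ = k≢k′
    ; out  = outside (col k v) (trans (value-col k) one)
    ; out′ = outside (col k′ v) (trans (value-col k′) one′) }
    where
    value-col : ∀ k → sumOver U (IAS A (col k v)) ≡ (coefA k ∧ a v) xor (coefI k ∧ lookup U v)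
    value-col k = trans (sumOver-cong U (λ i _ → IAS-col k v i)) (value-combo (coefA k) (coefI k) v)

  module _ {v : Fin n} (P : TwoOutside v) where
    open TwoOutside P

    outside-columns : List (Fin (W n))
    outside-columns = col k v ∷ col k′ v ∷ []

    apart-from : ∀ {w} k″ → w ≢ v → All (col k″ w ≢_) outside-columns
    apart-from {w} k″ w≢v =
      cols-of-vertices-apart {k″} {k} w≢v ∷ cols-of-vertices-apart {k″} {k′} w≢v ∷ []

    kinds-apart : col k v ≢ col k′ v
    kinds-apart = cols-of-kinds-apart {k} {k′} k≢k′

  -- three active vertices would put six columns outside S
  not-three-active : ∀ u w v → u ≢ w → u ≢ v → w ≢ v →
    active u ≡ true → active w ≡ true → active v ≡ true → ⊥
  not-three-active u w v u≢w u≢v w≢v act-u act-w act-v =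
    NP.<-irrefl refl (NP.≤-trans (members-bound (∁ S) six distinct outside-S) few-outside)
    where
    open TwoOutside
    P = two-outside u act-u
    Q = two-outside w act-w
    R = two-outside v act-v
    six : List (Fin (W n))
    six = outside-columns P ++ outside-columns Q ++ outside-columns R
    outside-S : All (_∈ᵇ ∁ S) six
    outside-S = out P ∷ out′ P ∷ out Q ∷ out′ Q ∷ out R ∷ out′ R ∷ []
    distinct : AllPairs _≢_ six
    distinct = (kinds-apart P ∷ AllP.++⁺ (apart-from Q (k P) u≢w) (apart-from R (k P) u≢v))
             ∷ AllP.++⁺ (apart-from Q (k′ P) u≢w) (apart-from R (k′ P) u≢v)
             ∷ (kinds-apart Q ∷ apart-from R (k Q) w≢v)
             ∷ apart-from R (k′ Q) w≢v
             ∷ (kinds-apart R ∷ [])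
             ∷ [] ∷ []

  t : Fin n → GF2Vec n
  t v = combo (lookup U v) (a v) v

  -- Σ_v t_v = A U + a = 0, by the symmetry of A
  t-sum : ∀ i → sumOver ⊤ (λ v → t v i) ≡ false
  t-sum i = begin
    sumOver ⊤ (λ v → t v i)
      ≡⟨ sumOver-xor ⊤ (λ v → lookup U v ∧ A i v) (λ v → a v ∧ δ i v) ⟩
    sumOver ⊤ (λ v → lookup U v ∧ A i v) xor sumOver ⊤ (λ v → a v ∧ δ i v)
      ≡⟨ cong₂ _xor_ (sumOver-indicator U (λ v → A i v)) select-i ⟩
    sumOver U (λ v → A i v) xor a i
      ≡⟨ cong (_xor a i) (sumOver-cong U (λ v _ → symA i v)) ⟩
    a i xor a i
      ≡⟨ BP.xor-same (a i) ⟩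
    false  ∎
    where
    open ≡-Reasoning
    select-i : sumOver ⊤ (λ v → a v ∧ δ i v) ≡ a i
    select-i = begin
      sumOver ⊤ (λ v → a v ∧ δ i v)
        ≡⟨ sumOver-point ⊤ i _ (λ v v≢i _ → trans (cong (a v ∧_) (δ-≢ (λ i≡v → v≢i (sym i≡v))))
                                                  (BP.∧-zeroʳ (a v))) ⟩
      lookup ⊤ i ∧ (a i ∧ δ i i)
        ≡⟨ cong₂ (λ x y → x ∧ (a i ∧ y)) (VP.lookup-replicate i true) (δ-refl i) ⟩
      a i ∧ true
        ≡⟨ BP.∧-identityʳ (a i) ⟩
      a i  ∎

  t-inactive : ∀ v → active v ≡ false → ∀ i → t v i ≡ false
  t-inactive v inact i
    rewrite BP.∨-conicalˡ (lookup U v) (a v) inact | BP.∨-conicalʳ (lookup U v) (a v) inact = refl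

  t-active : ∀ v → active v ≡ true → Σ Kind λ k → ∀ i → IAS A (col k v) i ≡ t v i
  t-active v act with kind-with (lookup U v) (a v) act
  ... | k , coefA≡ , coefI≡ = k , λ i →
          trans (IAS-col k v i) (cong₂ (λ p q → combo p q v i) coefA≡ coefI≡)

  -- with a single active vertex u, t_u = 0 is a zero column
  not-one-active : ∀ u → active u ≡ true → (∀ w → w ≢ u → active w ≡ false) → ⊥
  not-one-active u act others with t-active u act
  ... | k , col≡t = no-loop (IAS A) tc (double-≤-W (NP.≤-trans (s≤s z≤n) (FP.toℕ<n u))) (col k u) λ i →
          trans (col≡t i) (trans (sym (t-alone i)) (t-sum i))
    where
    t-alone : ∀ i → sumOver ⊤ (λ v → t v i) ≡ t u i
    t-alone i = trans (sumOver-point ⊤ u _ (λ v v≢u _ → t-inactive v (others v v≢u) i))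
                      (cong (_∧ t u i) (VP.lookup-replicate u true))

  -- with exactly two active vertices u, w, t_u = t_w is a parallel pair
  not-two-active : ∀ u w → u ≢ w → active u ≡ true → active w ≡ true →
    (∀ v → v ≢ u → v ≢ w → active v ≡ false) → ⊥
  not-two-active u w u≢w act-u act-w others with t-active u act-u | t-active w act-w
  ... | k , colu≡t | k′ , colw≡t =
    no-parallel (IAS A) tc (double-≤-W (two-vertices u w u≢w)) (col k u) (col k′ w)
      (cols-of-vertices-apart {k} {k′} u≢w) λ i →
        trans (colu≡t i) (trans (xor≡false⇒≡ (trans (sym (t-pair i)) (t-sum i))) (sym (colw≡t i)))
    where
    t-pair : ∀ i → sumOver ⊤ (λ v → t v i) ≡ t u i xor t w i
    t-pair i = trans (sumOver-twoPoints ⊤ u w _ u≢w (λ v v≢u v≢w _ → t-inactive v (others v v≢u v≢w) i))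
                     (cong₂ (λ x y → (x ∧ t u i) xor (y ∧ t w i))
                            (VP.lookup-replicate u true) (VP.lookup-replicate w true))

  -- every member of U is active, and there can be neither one, two nor three
  no-annihilator : Inhabited U → ⊥
  no-annihilator (u , u∈U) with FP.any? (λ w → ¬? (w ≟ u) ×-dec (active w BP.≟ true))
  ... | no none = not-one-active u act-u (λ w w≢u → ≢true⇒false (λ act → none (w , w≢u , act)))
    where act-u = cong (_∨ a u) u∈U
  ... | yes (w , w≢u , act-w)
    with FP.any? (λ v → ¬? (v ≟ u) ×-dec ¬? (v ≟ w) ×-dec (active v BP.≟ true))
  ...   | yes (v , v≢u , v≢w , act-v) =
    not-three-active u w v (λ u≡w → w≢u (sym u≡w)) (λ u≡v → v≢u (sym u≡v)) (λ w≡v → v≢w (sym w≡v))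
      (cong (_∨ a u) u∈U) act-w act-v
  ...   | no none =
    not-two-active u w (λ u≡w → w≢u (sym u≡w)) (cong (_∨ a u) u∈U) act-w
      (λ v v≢u v≢w → ≢true⇒false (λ act → none (v , v≢u , v≢w , act)))

few-outside : ∀ n (S : Subset (W n)) → 3 * n ∸ 5 ≤ ∣ S ∣ → ∣ ∁ S ∣ ≤ 5
few-outside n S big = subst (_≤ 5) (sym (SP.∣∁p∣≡n∸∣p∣ S))
  (NP.m≤n+o⇒m∸n≤o (W n) ∣ S ∣ (begin
    W n                  ≤⟨ NP.m≤n+m∸n (W n) 5 ⟩
    5 + (W n ∸ 5)        ≤⟨ NP.+-monoʳ-≤ 5 (subst (λ x → x ∸ 5 ≤ ∣ S ∣) three-n big) ⟩
    5 + ∣ S ∣            ≡⟨ NP.+-comm 5 ∣ S ∣ ⟩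
    ∣ S ∣ + 5            ∎))
  where
  open NP.≤-Reasoning
  three-n : 3 * n ≡ W n
  three-n = trans (cong (λ k → n + (n + k)) (NP.+-identityʳ n)) (sym (NP.+-assoc n n n))

lemma21 : (n : ℕ) (A : Graph n) → Symmetric A → ThreeConnected (IAS A) →
    ((S : Subset (W n)) → 4 ≤ ∣ S ∣ → 3 ≤ rank (IAS A) S)
    × ((S : Subset (W n)) → 3 * n ∸ 5 ≤ ∣ S ∣ → rank (IAS A) S ≡ n)
lemma21 n A symA tc = rank-≥3 (IAS A) tc , full-rank
  where
  full-rank : (S : Subset (W n)) → 3 * n ∸ 5 ≤ ∣ S ∣ → rank (IAS A) S ≡ n
  full-rank S big = NP.≤-antisym (rank-≤-dim (IAS A) S) n≤rank
    where
    n≤rank : n ≤ rank (IAS A) S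
    n≤rank with n NP.≤? rank (IAS A) S
    ... | yes n≤r = n≤r
    ... | no  n≰r with annihilator (IAS A) S (NP.≰⇒> n≰r)
    ...   | U , inh , ann = ⊥-elim (NoAnnihilator.no-annihilator A symA tc S (few-outside n S big) U ann inh)
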